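{- If string $T$ is periodic with period $p=\textsf{per}(T)<i-j+1$ and $(i-j+1) \bmod p = 0$, with $i \geq j$, the set of occurrences of $T$ in $T'=T[0..i]T[j..n-1]$ forms a single arithmetic progression with difference $p$.
   Context: $T$ is a string of length $n$ (indexed from $0$) and $i,j\in[0,n)$; $T[a..b]$ denotes the substring from position $a$ to position $b$ inclusive. An integer $p>0$ is a period of a string $P$ if $P[k]=P[k+p]$ for all $k\in[0,|P|-p)$; the smallest period of $P$ is denoted $\textsf{per}(P)$. A string $P$ is periodic if $\textsf{per}(P)\le |P|/2$. -}

module Defs where

open import Data.Nat using (ℕ; zero; suc; _+_; _*_; _<_; _≤_)
open import Data.List using (List; []; _∷_; length; take; drop; _++_)
open import Data.Maybe using (Maybe; just; nothing)
open import Data.Product using (_×_)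
open import Relation.Binary.PropositionalEquality using (_≡_)

at : ∀ {a} {A : Set a} → List A → ℕ → Maybe A
at []       _       = nothing
at (x ∷ xs) zero    = just x
at (x ∷ xs) (suc k) = at xs k

IsPeriod : ∀ {a} {A : Set a} → List A → ℕ → Set a
IsPeriod P p = (0 < p) × (∀ k → k + p < length P → at P k ≡ at P (k + p))

IsPer : ∀ {a} {A : Set a} → List A → ℕ → Set a
IsPer P p = IsPeriod P p × (∀ q → IsPeriod P q → p ≤ q)

-- substring S[a..b] (inclusive)
sub : ∀ {a} {A : Set a} → List A → ℕ → ℕ → List A
sub S a b = take (suc b Data.Nat.∸ a) (drop a S)

OccursAt : ∀ {a} {A : Set a} → List A → List A → ℕ → Set a
OccursAt T S k = take (length T) (drop k S) ≡ T

{-# OPTIONS --safe #-}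
module Submission where

-- Since p divides d = i - j + 1, the second factor of T' = T[0..i] T[j..n-1] starts at a position
-- congruent to j modulo p, so T', like T, is a prefix of the p-periodic word (T[0..p))^ω.  An
-- occurrence of T at k in T' therefore makes k mod p a period of T unless k mod p = 0, which the
-- minimality of p = per(T) forbids; conversely every multiple of p up to d is an occurrence.

open import Defs
open import Data.Nat using (ℕ; suc; _+_; _*_; _∸_; _<_; _≤_; _⊓_; NonZero; z≤n; s≤s; _<?_; _/_; _%_)
open import Data.Nat.Properties
open import Data.Nat.DivMod using (m≡m%n+[m/n]*n; [m+kn]%n≡m%n; m%n<n)
open import Data.Nat.Divisibility using (_∣_; divides; m%n≡0⇒n∣m)
open import Data.List using (List; []; _∷_; length; take; drop; _++_)
open import Data.List.Properties using (length-++; length-take; length-drop; take-all)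
open import Data.Maybe using (nothing)
open import Data.Maybe.Properties using (just-injective)
open import Data.Product using (_×_; _,_; proj₁; proj₂; ∃-syntax)
open import Function.Bundles using (_⇔_; mk⇔; module Equivalence)
open import Function.Properties.Equivalence using () renaming (refl to ⇔-refl; trans to ⇔-trans)
open import Data.Product.Function.NonDependent.Propositional using (_×-⇔_)
open import Relation.Binary.PropositionalEquality using (_≡_; refl; sym; trans; cong; cong₂; subst; subst₂; module ≡-Reasoning)
open import Relation.Nullary using (yes; no; ¬_)

module _ {a} {A : Set a} where

  at-≥length : ∀ (xs : List A) {x} → length xs ≤ x → at xs x ≡ nothing
  at-≥length []       _         = refl
  at-≥length (_ ∷ xs) (s≤s le) = at-≥length xs le

  at-++ˡ : ∀ (xs : List A) {ys x} → x < length xs → at (xs ++ ys) x ≡ at xs x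
  at-++ˡ (_ ∷ _)  {x = 0}     _          = refl
  at-++ˡ (_ ∷ xs) {x = suc x} (s≤s lt) = at-++ˡ xs lt

  at-++ʳ : ∀ (xs : List A) {ys} y → at (xs ++ ys) (length xs + y) ≡ at ys y
  at-++ʳ []       y = refl
  at-++ʳ (_ ∷ xs) y = at-++ʳ xs y

  at-take : ∀ m (xs : List A) {x} → x < m → at (take m xs) x ≡ at xs x
  at-take (suc m) []       _                = refl
  at-take (suc m) (_ ∷ xs) {0}     _        = refl
  at-take (suc m) (_ ∷ xs) {suc x} (s≤s lt) = at-take m xs lt

  at-drop : ∀ k (xs : List A) x → at (drop k xs) x ≡ at xs (k + x)
  at-drop 0       xs       x = refl
  at-drop (suc k) []       x = refl
  at-drop (suc k) (_ ∷ xs) x = at-drop k xs x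

  at-extensional : ∀ {xs ys : List A} → (∀ x → at xs x ≡ at ys x) → xs ≡ ys
  at-extensional {[]}     {[]}     _  = refl
  at-extensional {[]}     {_ ∷ _}  eq with eq 0
  ... | ()
  at-extensional {_ ∷ _}  {[]}     eq with eq 0
  ... | ()
  at-extensional {_ ∷ _}  {_ ∷ _}  eq =
    cong₂ _∷_ (just-injective (eq 0)) (at-extensional (λ x → eq (suc x)))

  sub-to-end : ∀ (T : List A) j → sub T j (length T ∸ 1) ≡ drop j T
  sub-to-end T j = take-all _ (drop j T) (begin
    length (drop j T)        ≡⟨ length-drop j T ⟩
    length T ∸ j             ≤⟨ ∸-monoˡ-≤ j (m≤n+m∸n (length T) 1) ⟩
    suc (length T ∸ 1) ∸ j   ∎)
    where open ≤-Reasoning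

  occursAt⇔pointwise : ∀ (T S : List A) k →
    OccursAt T S k ⇔ (∀ x → x < length T → at S (k + x) ≡ at T x)
  occursAt⇔pointwise T S k = mk⇔ to from
    where
    window = take (length T) (drop k S)

    at-window : ∀ {x} → x < length T → at window x ≡ at S (k + x)
    at-window {x} lt = trans (at-take (length T) (drop k S) lt) (at-drop k S x)

    length-window≤ : length window ≤ length T
    length-window≤ = ≤-trans (≤-reflexive (length-take (length T) (drop k S))) (m⊓n≤m _ _)

    to : OccursAt T S k → ∀ x → x < length T → at S (k + x) ≡ at T x
    to occ x lt = trans (sym (at-window lt)) (cong (λ W → at W x) occ)

    from : (∀ x → x < length T → at S (k + x) ≡ at T x) → OccursAt T S k
    from eq = at-extensional pointwise
      where
      pointwise : ∀ x → at window x ≡ at T x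
      pointwise x with x <? length T
      ... | yes lt = trans (at-window lt) (eq x lt)
      ... | no  x≮T = trans (at-≥length window (≤-trans length-window≤ (≮⇒≥ x≮T)))
                            (sym (at-≥length T (≮⇒≥ x≮T)))

  occursAt⇒length+≤ : ∀ (T S : List A) {k} → 0 < length T → OccursAt T S k →
    length T + k ≤ length S
  occursAt⇒length+≤ T S {k} T≢[] occ = m≤o∸n⇒m+n≤o (length T) k≤S n≤S∸k
    where
    n≤S∸k : length T ≤ length S ∸ k
    n≤S∸k = begin
      length T                                ≡⟨ cong length (sym occ) ⟩
      length (take (length T) (drop k S))     ≡⟨ length-take (length T) (drop k S) ⟩
      length T ⊓ length (drop k S)            ≤⟨ m⊓n≤n (length T) _ ⟩
      length (drop k S)                       ≡⟨ length-drop k S ⟩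
      length S ∸ k                            ∎
      where open ≤-Reasoning
    k≤S : k ≤ length S
    k≤S = <⇒≤ (m∸n≢0⇒n<m (λ eq → <⇒≱ T≢[] (subst (length T ≤_) eq n≤S∸k)))

module _ {a} {A : Set a} (P : List A) {p} (period : IsPeriod P p) where

  at-+*period : ∀ q x → x + q * p < length P → at P (x + q * p) ≡ at P x
  at-+*period 0       x _  = cong (at P) (+-identityʳ x)
  at-+*period (suc q) x lt = begin
    at P (x + (p + q * p))  ≡⟨ cong (at P) regroup ⟩
    at P (y + p)            ≡⟨ sym (proj₂ period y y+p<P) ⟩
    at P y                  ≡⟨ at-+*period q x (≤-<-trans (m≤m+n y p) y+p<P) ⟩
    at P x                  ∎
    where
    open ≡-Reasoning
    y = x + q * p
    regroup : x + (p + q * p) ≡ y + p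
    regroup = trans (cong (x +_) (+-comm p (q * p))) (sym (+-assoc x (q * p) p))
    y+p<P : y + p < length P
    y+p<P = subst (_< length P) regroup lt

  module _ .{{_ : NonZero p}} where

    at-%period : ∀ x → x < length P → at P x ≡ at P (x % p)
    at-%period x lt = sym (begin
      at P (x % p)                  ≡⟨ sym (at-+*period (x / p) (x % p) (subst (_< length P) x≡ lt)) ⟩
      at P (x % p + (x / p) * p)    ≡⟨ cong (at P) (sym x≡) ⟩
      at P x                        ∎)
      where
      open ≡-Reasoning
      x≡ = m≡m%n+[m/n]*n x p

    %-isPeriod : ∀ k → (∀ x → x < length P → at P ((k + x) % p) ≡ at P x) →
      0 < k % p → IsPeriod P (k % p)
    %-isPeriod k shifted r>0 = r>0 , λ y y+r<P → begin
      at P y                            ≡⟨ sym (shifted y (≤-<-trans (m≤m+n y r) y+r<P)) ⟩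
      at P ((k + y) % p)                ≡⟨ cong (λ z → at P (z % p)) (k+y≡ y) ⟩
      at P ((y + r + (k / p) * p) % p)  ≡⟨ cong (at P) ([m+kn]%n≡m%n (y + r) (k / p) p) ⟩
      at P ((y + r) % p)                ≡⟨ sym (at-%period (y + r) y+r<P) ⟩
      at P (y + r)                      ∎
      where
      open ≡-Reasoning
      r = k % p
      k+y≡ : ∀ y → k + y ≡ y + r + (k / p) * p
      k+y≡ y = trans (+-comm k y) (trans (cong (y +_) (m≡m%n+[m/n]*n k p)) (sym (+-assoc y r _)))

module _ {a} {A : Set a} (P : List A) {p} .{{_ : NonZero p}} (per : IsPer P p) where

  per-∣-shift : ∀ k → (∀ x → x < length P → at P ((k + x) % p) ≡ at P x) → p ∣ k
  per-∣-shift k shifted = m%n≡0⇒n∣m k p (n≤0⇒n≡0 (≮⇒≥ k%p≯0))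
    where
    k%p≯0 : ¬ 0 < k % p
    k%p≯0 k%p>0 = <⇒≱ (m%n<n k p) (proj₂ per (k % p) (%-isPeriod P (proj₁ per) k shifted k%p>0))

module _ {a} {A : Set a} (T : List A) {p} .{{_ : NonZero p}} (per : IsPer T p)
  (S : List A) (S-periodic : ∀ z → z < length S → at S z ≡ at T (z % p)) where

  private
    fits⇒<length : ∀ {k x} → length T + k ≤ length S → x < length T → k + x < length S
    fits⇒<length {k} {x} fits x<T = <-≤-trans (subst (k + x <_) (+-comm k (length T)) (+-monoʳ-< k x<T)) fits

  occursAt⇒multiple : 0 < length T → ∀ {k} → OccursAt T S k → length T + k ≤ length S × p ∣ k
  occursAt⇒multiple T≢[] {k} occ = fits , per-∣-shift T per k shifted
    where
    fits = occursAt⇒length+≤ T S T≢[] occ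
    shifted : ∀ x → x < length T → at T ((k + x) % p) ≡ at T x
    shifted x x<T = trans (sym (S-periodic (k + x) (fits⇒<length fits x<T)))
                          (Equivalence.to (occursAt⇔pointwise T S k) occ x x<T)

  multiple⇒occursAt : ∀ {k} → length T + k ≤ length S × p ∣ k → OccursAt T S k
  multiple⇒occursAt (fits , divides t refl) = Equivalence.from (occursAt⇔pointwise T S _) λ x x<T → begin
    at S (t * p + x)        ≡⟨ S-periodic _ (fits⇒<length fits x<T) ⟩
    at T ((t * p + x) % p)  ≡⟨ cong (λ z → at T (z % p)) (+-comm (t * p) x) ⟩
    at T ((x + t * p) % p)  ≡⟨ cong (at T) ([m+kn]%n≡m%n x t p) ⟩
    at T (x % p)            ≡⟨ sym (at-%period T (proj₁ per) x x<T) ⟩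
    at T x                  ∎
    where open ≡-Reasoning

  occursAt⇔multiple : 0 < length T → ∀ k → OccursAt T S k ⇔ (length T + k ≤ length S × p ∣ k)
  occursAt⇔multiple T≢[] k = mk⇔ (occursAt⇒multiple T≢[]) multiple⇒occursAt

module _ {a} {A : Set a} (T : List A) {j m} (j≤m : j ≤ m) (m≤T : m ≤ length T) where

  private
    length-take-m : length (take m T) ≡ m
    length-take-m = trans (length-take m T) (m≤n⇒m⊓n≡m m≤T)

    j+y+[m∸j]≡m+y : ∀ y → j + y + (m ∸ j) ≡ m + y
    j+y+[m∸j]≡m+y y = begin
      j + y + (m ∸ j)    ≡⟨ +-assoc j y (m ∸ j) ⟩
      j + (y + (m ∸ j))  ≡⟨ cong (j +_) (+-comm y (m ∸ j)) ⟩
      j + ((m ∸ j) + y)  ≡⟨ sym (+-assoc j (m ∸ j) y) ⟩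
      j + (m ∸ j) + y    ≡⟨ cong (_+ y) (m+[n∸m]≡n j≤m) ⟩
      m + y              ∎
      where open ≡-Reasoning

  length-take++drop : length (take m T ++ drop j T) ≡ length T + (m ∸ j)
  length-take++drop = begin
    length (take m T ++ drop j T)          ≡⟨ length-++ (take m T) ⟩
    length (take m T) + length (drop j T)  ≡⟨ cong₂ _+_ length-take-m (length-drop j T) ⟩
    m + (length T ∸ j)                     ≡⟨ cong (_+ (length T ∸ j)) (sym (m∸n+n≡m j≤m)) ⟩
    (m ∸ j) + j + (length T ∸ j)           ≡⟨ +-assoc (m ∸ j) j (length T ∸ j) ⟩
    (m ∸ j) + (j + (length T ∸ j))         ≡⟨ cong ((m ∸ j) +_) (m+[n∸m]≡n (≤-trans j≤m m≤T)) ⟩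
    (m ∸ j) + length T                     ≡⟨ +-comm (m ∸ j) (length T) ⟩
    length T + (m ∸ j)                     ∎
    where open ≡-Reasoning

  module _ {p} .{{_ : NonZero p}} (period : IsPeriod T p) (p∣m∸j : p ∣ m ∸ j) where

    private
      S = take m T ++ drop j T

      at-take++drop-≥ : ∀ y → m + y < length S → at S (m + y) ≡ at T ((m + y) % p)
      at-take++drop-≥ y m+y<S = begin
        at S (m + y)                   ≡⟨ cong (λ l → at S (l + y)) (sym length-take-m) ⟩
        at S (length (take m T) + y)   ≡⟨ at-++ʳ (take m T) y ⟩
        at (drop j T) y                ≡⟨ at-drop j T y ⟩
        at T (j + y)                   ≡⟨ at-%period T period (j + y) j+y<T ⟩
        at T ((j + y) % p)             ≡⟨ cong (at T) (sym ([m+kn]%n≡m%n (j + y) c p)) ⟩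
        at T ((j + y + c * p) % p)     ≡⟨ cong (λ z → at T ((j + y + z) % p)) (sym m∸j≡c*p) ⟩
        at T ((j + y + (m ∸ j)) % p)   ≡⟨ cong (λ z → at T (z % p)) (j+y+[m∸j]≡m+y y) ⟩
        at T ((m + y) % p)             ∎
        where
        open ≡-Reasoning
        open _∣_ p∣m∸j renaming (quotient to c; equality to m∸j≡c*p)
        j+y<T : j + y < length T
        j+y<T = +-cancelʳ-< (m ∸ j) (j + y) (length T)
          (subst₂ _<_ (sym (j+y+[m∸j]≡m+y y)) length-take++drop m+y<S)

    at-take++drop : ∀ z → z < length S → at S z ≡ at T (z % p)
    at-take++drop z z<S with z <? m
    ... | yes z<m = begin
      at S z            ≡⟨ at-++ˡ (take m T) (subst (z <_) (sym length-take-m) z<m) ⟩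
      at (take m T) z   ≡⟨ at-take m T z<m ⟩
      at T z            ≡⟨ at-%period T period z (<-≤-trans z<m m≤T) ⟩
      at T (z % p)      ∎
      where open ≡-Reasoning
    ... | no z≮m = subst (λ z → z < length S → at S z ≡ at T (z % p))
                         (m+[n∸m]≡n (≮⇒≥ z≮m)) (at-take++drop-≥ (z ∸ m)) z<S

  occursAt-take++drop⇔ : ∀ {p} .{{_ : NonZero p}} → IsPer T p → p ∣ m ∸ j → 0 < length T → ∀ k →
    OccursAt T (take m T ++ drop j T) k ⇔ (k ≤ m ∸ j × p ∣ k)
  occursAt-take++drop⇔ per p∣m∸j T≢[] k =
    ⇔-trans (occursAt⇔multiple T per _ (at-take++drop (proj₁ per) p∣m∸j) T≢[] k) (fits⇔ ×-⇔ ⇔-refl)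
    where
    fits⇔ : length T + k ≤ length (take m T ++ drop j T) ⇔ k ≤ m ∸ j
    fits⇔ = mk⇔ (λ fits → +-cancelˡ-≤ (length T) k (m ∸ j) (subst (length T + k ≤_) length-take++drop fits))
                (λ k≤ → subst (length T + k ≤_) (sym length-take++drop) (+-monoʳ-≤ (length T) k≤))

≤×∣⇔multiple : ∀ {k d p} .{{_ : NonZero p}} (p∣d : p ∣ d) →
  (k ≤ d × p ∣ k) ⇔ (∃[ t ] (t < suc (_∣_.quotient p∣d) × k ≡ t * p))
≤×∣⇔multiple {p = p} (divides c refl) = mk⇔
  (λ { (k≤c*p , divides t refl) → t , s≤s (*-cancelʳ-≤ t c p k≤c*p) , refl })
  (λ { (t , s≤s t≤c , refl) → *-monoˡ-≤ p t≤c , divides t refl })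

corollary1 : ∀ {a} {A : Set a} (T : List A) (i j p : ℕ) →
    i < length T → j < length T → j ≤ i →
    IsPer T p → 2 * p ≤ length T →
    p < suc i ∸ j → p ∣ (suc i ∸ j) →
    ∃[ s ] ∃[ m ] (∀ k → OccursAt T (sub T 0 i ++ sub T j (length T ∸ 1)) k ⇔ (∃[ t ] (t < m × k ≡ s + t * p)))
corollary1 T i j 0         _   _ _   ((() , _) , _) _ _ _
corollary1 T i j p@(suc _) i<T _ j≤i per            _ _ p∣d rewrite sub-to-end T j =
  0 , suc (_∣_.quotient p∣d) , λ k →
    ⇔-trans (occursAt-take++drop⇔ T (m≤n⇒m≤1+n j≤i) i<T per p∣d (≤-<-trans z≤n i<T) k)
            (≤×∣⇔multiple p∣d)
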